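{- Let $\langle R,\sim\rangle$ be the Rado graph, $L\in\mathbb P(R)$, and let $\langle\{L_n:n\in\omega\},\{q^{\bigcup_{i<n}L_i}_K:n\in\omega,K\subset\bigcup_{i<n}L_i\}\rangle$ be a labeling of $L$. Define $\le_L$ on $L$ by $q^{\bigcup_{i<m}L_i}_{K'}\le_L q^{\bigcup_{i<n}L_i}_{K''}$ iff $L^{\bigcup_{i<m}L_i}_{K'}\subset L^{\bigcup_{i<n}L_i}_{K''}$. Then for each $n\in\omega$ and $K\subset\bigcup_{i<n}L_i$, in the poset $\langle L,\le_L\rangle$: (a) $(q^{\bigcup_{i<n}L_i}_K,q^\emptyset_\emptyset]=\{q^{\bigcup_{i<m}L_i}_{K\cap\bigcup_{i<m}L_i}:m<n\}$; (b) $\langle L,\le_L\rangle$ is a reversed tree with the top $q^\emptyset_\emptyset$ and the set $L_n$ is its $n$-th level; (c) $(-\infty,q^{\bigcup_{i<n}L_i}_K]=L^{\bigcup_{i<n}L_i}_K$; (d) the set of immediate predecessors of $q^{\bigcup_{i<n}L_i}_K$ in $\langle L,\le_L\rangle$ equals $\{q^{\bigcup_{i<n+1}L_i}_{K\cup K_1}:K_1\subset L_n\}$; (e) $\langle L,\le_L\rangle$ is a finitely branching reversed tree without minimal nodes; in fact each element of $L_n$ has $2^{|L_n|}=2^{m_n}$ immediate predecessors.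
   Context: The Rado graph $\langle R,\sim\rangle$ is the unique countable graph such that $R^H_K\neq\emptyset$ for all finite $K\subset H\subset R$, where $R^H_K=\{v\in R\setminus H:\forall k\in K\,(v\sim k)\wedge\forall h\in H\setminus K\,(v\not\sim h)\}$; for $L\subset R$, $L^H_K=L\cap R^H_K$. $\mathbb P(R)$ is the set of subsets of $R$ whose induced subgraph is isomorphic to $R$. A labeling of $L\in\mathbb P(R)$ is a partition $\{L_n:n\in\omega\}$ of $L$ together with a bijection $(n,K)\mapsto q^{\bigcup_{i<n}L_i}_K$ from $\bigcup_n\{n\}\times P(\bigcup_{i<n}L_i)$ onto $L$ with $L_n=\{q^{\bigcup_{i<n}L_i}_K:K\subset\bigcup_{i<n}L_i\}$ and $q^{\bigcup_{i<n}L_i}_K\in L^{\bigcup_{i<n}L_i}_K$. The integers $m_n$ are $m_0=1$, $m_n=2^{\sum_{i<n}m_i}$. Intervals $(p,q]$ and $(-\infty,q]$ are taken in $\langle L,\le_L\rangle$. A reversed tree is a poset whose reverse is a tree; its $n$-th level consists of elements having exactly $n$ elements strictly above them; $p$ is an immediate predecessor of $q$ iff $p<_L q$ and there is nothing strictly between them. -}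

module Defs where

open import Level using (0ℓ)
open import Data.Nat using (ℕ; zero; suc; _+_; _^_; _<_)
open import Data.List using (List; []; length)
open import Data.List.Membership.Propositional using (_∈_; _∉_)
open import Data.List.Relation.Unary.Unique.Propositional using (Unique)
open import Data.List.Relation.Binary.Subset.Propositional renaming (_⊆_ to _⊆ˡ_)
open import Data.Product using (Σ; _×_; _,_; ∃)
open import Data.Sum using (_⊎_)
open import Relation.Nullary using (¬_)
open import Relation.Unary using (Pred; _⊆_; _≐_; _∩_)
open import Relation.Binary.PropositionalEquality using (_≡_; _≢_)
open import Induction.WellFounded using (WellFounded)
open import Function.Bundles using (_⇔_)

record Graph : Set₁ where
  field
    _∼_     : ℕ → ℕ → Set
    ∼-sym   : ∀ {x y} → x ∼ y → y ∼ x
    ∼-irref : ∀ {x} → ¬ (x ∼ x)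

_⊆ᴾ_ : List ℕ → Pred ℕ 0ℓ → Set
K ⊆ᴾ P = ∀ {x} → x ∈ K → P x

⟦_⟧ : List ℕ → Pred ℕ 0ℓ
⟦ K ⟧ x = x ∈ K

HasSize : Pred ℕ 0ℓ → ℕ → Set
HasSize P n = Σ (List ℕ) λ l → Unique l × length l ≡ n × (⟦ l ⟧ ≐ P)

mutual
  m : ℕ → ℕ
  m zero    = 1
  m (suc n) = 2 ^ S (suc n)

  S : ℕ → ℕ
  S zero    = 0
  S (suc n) = S n + m n

Strict : (ℕ → ℕ → Set) → ℕ → ℕ → Set
Strict _≤_ x y = x ≤ y × x ≢ y

ImmPred : (ℕ → ℕ → Set) → ℕ → Pred ℕ 0ℓ
ImmPred _≤_ x y = Strict _≤_ y x × ¬ (∃ λ z → Strict _≤_ y z × Strict _≤_ z x)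

-- A reversed tree: a partial order on A whose reverse is a tree, i.e.
-- for every x the set of elements strictly above x is well-ordered by
-- the reverse order (linear, and >-well-founded).
record ReversedTree (A : Pred ℕ 0ℓ) (_≤_ : ℕ → ℕ → Set) : Set where
  _⊏_ = Strict _≤_
  field
    dom      : ∀ {x y} → x ≤ y → A x × A y
    reflexive : ∀ {x} → A x → x ≤ x
    trans    : ∀ {x y z} → x ≤ y → y ≤ z → x ≤ z
    antisym  : ∀ {x y} → x ≤ y → y ≤ x → x ≡ y
    above-linear : ∀ {x y z} → A x → x ⊏ y → x ⊏ z → (y ≤ z) ⊎ (z ≤ y)
    above-wf : ∀ {x} → A x → WellFounded (λ a b → x ⊏ a × x ⊏ b × b ⊏ a)

Level : (ℕ → ℕ → Set) → Pred ℕ 0ℓ → ℕ → Pred ℕ 0ℓ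
Level _≤_ A n x = A x × HasSize (Strict _≤_ x) n

module _ (G : Graph) where
  open Graph G

  Ext : Pred ℕ 0ℓ → List ℕ → Pred ℕ 0ℓ
  Ext H K v = ¬ H v × (∀ {k} → k ∈ K → v ∼ k) × (∀ {h} → H h → h ∉ K → ¬ (v ∼ h))

  IsRado : Set
  IsRado = ∀ (H K : List ℕ) → K ⊆ˡ H → ∃ λ v → Ext ⟦ H ⟧ K v

  InP : Pred ℕ 0ℓ → Set
  InP L = Σ (ℕ → ℕ) λ f →
            (∀ x → L (f x))
          × (∀ x y → f x ≡ f y → x ≡ y)
          × (∀ y → L y → ∃ λ x → f x ≡ y)
          × (∀ x y → (x ∼ y → f x ∼ f y) × (f x ∼ f y → x ∼ y))

  Below : (ℕ → Pred ℕ 0ℓ) → ℕ → Pred ℕ 0ℓ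
  Below part n x = ∃ λ i → i < n × part i x

  _≈ˡ_ : List ℕ → List ℕ → Set
  K ≈ˡ K' = ⟦ K ⟧ ≐ ⟦ K' ⟧

  -- A labeling of L: a partition {Lₙ} of L and a bijection
  -- (n , K) ↦ q n K  (K ⊆ ⋃_{i<n} Lᵢ, finite subsets given as lists,
  -- identified up to set equality) onto L.
  record Labeling (L : Pred ℕ 0ℓ) : Set₁ where
    field
      part : ℕ → Pred ℕ 0ℓ
      q    : ℕ → List ℕ → ℕ
      part-⊆   : ∀ n → part n ⊆ L
      part-cover : ∀ {x} → L x → ∃ λ n → part n x
      part-disj  : ∀ {m n x} → part m x → part n x → m ≡ n
      q-wd  : ∀ n {K K'} → K ⊆ᴾ Below part n → K ≈ˡ K' → q n K ≡ q n K'
      q-ext : ∀ n {K} → K ⊆ᴾ Below part n → (L ∩ Ext (Below part n) K) (q n K)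
      q-inj : ∀ {n n' K K'} → K ⊆ᴾ Below part n → K' ⊆ᴾ Below part n' →
              q n K ≡ q n' K' → n ≡ n' × K ≈ˡ K'
      q-surj : ∀ {x} → L x → ∃ λ n → ∃ λ K → K ⊆ᴾ Below part n × q n K ≡ x
      part-def : ∀ n {x} → part n x ⇔ (∃ λ K → K ⊆ᴾ Below part n × q n K ≡ x)

    U : ℕ → Pred ℕ 0ℓ
    U = Below part

    LExt : ℕ → List ℕ → Pred ℕ 0ℓ
    LExt n K = L ∩ Ext (U n) K

    _≤L_ : ℕ → ℕ → Set
    x ≤L y = ∃ λ m → ∃ λ K' → ∃ λ n → ∃ λ K'' →
               K' ⊆ᴾ U m × K'' ⊆ᴾ U n × q m K' ≡ x × q n K'' ≡ y
             × LExt m K' ⊆ LExt n K''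

    _<L_ : ℕ → ℕ → Set
    _<L_ = Strict _≤L_

    top : ℕ
    top = q 0 []

-- The whole theorem rests on one observation: L^{U m}_{K'} ⊆ L^{U n}_K holds iff
-- n ≤ m and K = K' ∩ U n. Indeed q^{U m}_{K'} lies in the left-hand side, and
-- both labels prescribe its adjacency to U n ⊆ U m. So ≤_L is the restriction
-- order on labels: above a label of level n lie exactly its restrictions to the
-- levels k < n, and its immediate predecessors are its extensions to level n + 1
-- by the 2^{|L_n|} subsets of L_n.
module Submission where

open import Defs
open import Level using (0ℓ)
open import Data.Nat using (ℕ; zero; suc; _<_; _^_; _≤_; _+_; z≤n; _≤?_)
open import Data.Nat.Properties
open import Data.Nat.Induction using (<-wellFounded)
open import Data.List using (List; []; _∷_; _++_; map; length; filter; upTo)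
open import Data.List.Properties using (length-map; length-++; length-upTo; map-++; map-∘)
open import Data.List.Membership.Propositional using (_∈_; _∉_)
open import Data.List.Membership.Propositional.Properties
open import Data.List.Membership.Propositional.Properties.WithK using (unique∧set⇒bag)
open import Data.List.Membership.DecPropositional _≟_ using (_∈?_)
open import Data.List.Relation.Binary.Subset.Propositional using () renaming (_⊆_ to _⊆ˡ_)
open import Data.List.Relation.Binary.Subset.Propositional.Properties using (xs⊆x∷xs; ∷⁺ʳ)
open import Data.List.Relation.Binary.BagAndSetEquality using (∼bag⇒↭)
open import Data.List.Relation.Binary.Permutation.Propositional.Properties using (↭-length)
open import Data.List.Relation.Unary.Any using (here; there)
open import Data.List.Relation.Unary.All using ([])
open import Data.List.Relation.Unary.Unique.Propositional using (Unique; []; _∷_)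
open import Data.List.Relation.Unary.Unique.Propositional.Properties
  using (++⁺; map⁺; upTo⁺; Unique[x∷xs]⇒x∉xs)
open import Data.Product using (Σ; _×_; ∃; _,_; proj₁; proj₂; swap)
open import Data.Sum using (_⊎_; inj₁; inj₂)
open import Function using (_∘_; flip)
open import Function.Bundles using (mk⇔; Equivalence)
open import Relation.Nullary using (¬_; yes; no; contradiction)
open import Relation.Nullary.Decidable using (map′; ¬?)
open import Relation.Unary using (Pred; Decidable; _≐_; _∩_; _⊆_)
open import Relation.Binary.PropositionalEquality
open import Induction.WellFounded using (Acc; acc; WellFounded; module Subrelation)

subsets : List ℕ → List (List ℕ)
subsets []      = [] ∷ []
subsets (x ∷ l) = map (x ∷_) (subsets l) ++ subsets l

length-subsets : ∀ l → length (subsets l) ≡ 2 ^ length l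
length-subsets [] = refl
length-subsets (x ∷ l) = begin
  length (map (x ∷_) (subsets l) ++ subsets l)
    ≡⟨ length-++ (map (x ∷_) (subsets l)) ⟩
  length (map (x ∷_) (subsets l)) + length (subsets l)
    ≡⟨ cong (_+ length (subsets l)) (length-map (x ∷_) (subsets l)) ⟩
  length (subsets l) + length (subsets l)
    ≡⟨ cong (λ k → k + k) (length-subsets l) ⟩
  2 ^ length l + 2 ^ length l
    ≡⟨ cong (2 ^ length l +_) (sym (+-identityʳ (2 ^ length l))) ⟩
  2 ^ suc (length l) ∎
  where open ≡-Reasoning

∈-subsets⁻ : ∀ l {A} → A ∈ subsets l → A ⊆ˡ l
∈-subsets⁻ []      (here refl) ()
∈-subsets⁻ (x ∷ l) A∈ y∈A with ∈-++⁻ (map (x ∷_) (subsets l)) A∈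
... | inj₂ A∈′ = there (∈-subsets⁻ l A∈′ y∈A)
... | inj₁ xB∈ with B , B∈ , refl ← ∈-map⁻ (x ∷_) xB∈ with y∈A
...   | here y≡x  = here y≡x
...   | there y∈B = there (∈-subsets⁻ l B∈ y∈B)

filter∈subsets : ∀ {P : Pred ℕ 0ℓ} (P? : Decidable P) l → filter P? l ∈ subsets l
filter∈subsets P? [] = here refl
filter∈subsets P? (x ∷ l) with P? x
... | yes _ = ∈-++⁺ˡ (∈-map⁺ (x ∷_) (filter∈subsets P? l))
... | no _  = ∈-++⁺ʳ (map (x ∷_) (subsets l)) (filter∈subsets P? l)

filter-∈-≐ : ∀ {K l} → K ⊆ˡ l → ⟦ filter (_∈? K) l ⟧ ≐ ⟦ K ⟧
filter-∈-≐ {K} {l} K⊆l =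
  (λ y∈ → proj₂ (∈-filter⁻ (_∈? K) {xs = l} y∈)) , (λ y∈K → ∈-filter⁺ (_∈? K) (K⊆l y∈K) y∈K)

++-≐ʳ : ∀ K {A B} → ⟦ A ⟧ ≐ ⟦ B ⟧ → ⟦ K ++ A ⟧ ≐ ⟦ K ++ B ⟧
++-≐ʳ K {A} {B} (A⊆B , B⊆A) = mono A⊆B , mono B⊆A
  where
  mono : ∀ {A B} → A ⊆ˡ B → ⟦ K ++ A ⟧ ⊆ ⟦ K ++ B ⟧
  mono A⊆B y∈ with ∈-++⁻ K y∈
  ... | inj₁ y∈K = ∈-++⁺ˡ y∈K
  ... | inj₂ y∈A = ∈-++⁺ʳ K (A⊆B y∈A)

++-cancelˡ-≐ : ∀ K {A B} → (∀ {y} → y ∈ A → y ∉ K) → (∀ {y} → y ∈ B → y ∉ K) →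
               ⟦ K ++ A ⟧ ≐ ⟦ K ++ B ⟧ → ⟦ A ⟧ ≐ ⟦ B ⟧
++-cancelˡ-≐ K A#K B#K (KA⊆KB , KB⊆KA) = cancel A#K KA⊆KB , cancel B#K KB⊆KA
  where
  cancel : ∀ {A B} → (∀ {y} → y ∈ A → y ∉ K) → ⟦ K ++ A ⟧ ⊆ ⟦ K ++ B ⟧ → A ⊆ˡ B
  cancel A#K KA⊆KB y∈A with ∈-++⁻ K (KA⊆KB (∈-++⁺ʳ K y∈A))
  ... | inj₁ y∈K = contradiction y∈K (A#K y∈A)
  ... | inj₂ y∈B = y∈B

map-subsets-unique : ∀ {l} → Unique l → (f : List ℕ → ℕ) →
                     (∀ {A B} → A ⊆ˡ l → B ⊆ˡ l → f A ≡ f B → ⟦ A ⟧ ≐ ⟦ B ⟧) →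
                     Unique (map f (subsets l))
map-subsets-unique {[]}    _ f _ = [] ∷ []
map-subsets-unique {x ∷ l} u@(_ ∷ uₗ) f f-inj =
  subst Unique (sym (map-++ f (map (x ∷_) (subsets l)) (subsets l)))
    (++⁺ (subst Unique (map-∘ (subsets l)) with-x) without-x disjoint)
  where
  x∉l : x ∉ l
  x∉l = Unique[x∷xs]⇒x∉xs u

  x-fresh : ∀ {A} → A ⊆ˡ l → ∀ {y} → y ∈ A → y ∉ x ∷ []
  x-fresh A⊆l y∈A (here refl) = x∉l (A⊆l y∈A)

  with-x : Unique (map (f ∘ (x ∷_)) (subsets l))
  with-x = map-subsets-unique uₗ (f ∘ (x ∷_)) λ A⊆l B⊆l fxA≡fxB →
    ++-cancelˡ-≐ (x ∷ []) (x-fresh A⊆l) (x-fresh B⊆l) (f-inj (∷⁺ʳ x A⊆l) (∷⁺ʳ x B⊆l) fxA≡fxB)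

  without-x : Unique (map f (subsets l))
  without-x = map-subsets-unique uₗ f λ A⊆l B⊆l →
    f-inj (xs⊆x∷xs l x ∘ A⊆l) (xs⊆x∷xs l x ∘ B⊆l)

  disjoint : ∀ {v} → ¬ (v ∈ map f (map (x ∷_) (subsets l)) × v ∈ map f (subsets l))
  disjoint (v∈₁ , v∈₂)
    with xA , xA∈ , refl ← ∈-map⁻ f v∈₁
    with A , A∈ , refl ← ∈-map⁻ (x ∷_) xA∈
    with B , B∈ , fxA≡fB ← ∈-map⁻ f v∈₂ =
    x∉l (∈-subsets⁻ l B∈ (proj₁ (f-inj (∷⁺ʳ x (∈-subsets⁻ l A∈))
                                        (xs⊆x∷xs l x ∘ ∈-subsets⁻ l B∈) fxA≡fB) (here refl)))

HasSize-unique : ∀ {P a b} → HasSize P a → HasSize P b → a ≡ b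
HasSize-unique (l₁ , u₁ , refl , l₁≐P) (l₂ , u₂ , refl , l₂≐P) =
  ↭-length (∼bag⇒↭ (unique∧set⇒bag u₁ u₂
    (mk⇔ (λ y∈l₁ → proj₂ l₂≐P (proj₁ l₁≐P y∈l₁)) (λ y∈l₂ → proj₂ l₁≐P (proj₁ l₂≐P y∈l₂)))))

m≡2^S : ∀ n → m n ≡ 2 ^ S n
m≡2^S zero    = refl
m≡2^S (suc n) = refl

module LabelOrder (G : Graph) (L : Pred ℕ 0ℓ) (lab : Labeling G L) where
  open Graph G
  open Labeling lab

  U-mono : ∀ {k n} → k ≤ n → U k ⊆ U n
  U-mono k≤n (i , i<k , x∈Lᵢ) = i , <-≤-trans i<k k≤n , x∈Lᵢ

  part-q : ∀ n {K} → K ⊆ᴾ U n → part n (q n K)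
  part-q n K⊆U = Equivalence.from (part-def n) (_ , K⊆U , refl)

  part-∉U : ∀ n {x} → part n x → ¬ U n x
  part-∉U n x∈Lₙ (i , i<n , x∈Lᵢ) = <⇒≢ i<n (part-disj x∈Lᵢ x∈Lₙ)

  mutual
    U-list : ℕ → List ℕ
    U-list zero    = []
    U-list (suc n) = U-list n ++ part-list n

    part-list : ℕ → List ℕ
    part-list n = map (q n) (subsets (U-list n))

  mutual
    U-list-sound : ∀ n → ⟦ U-list n ⟧ ⊆ U n
    U-list-sound zero ()
    U-list-sound (suc n) x∈ with ∈-++⁻ (U-list n) x∈
    ... | inj₁ x∈U = U-mono (n≤1+n n) (U-list-sound n x∈U)
    ... | inj₂ x∈P = n , n<1+n n , part-list-sound n x∈P

    part-list-sound : ∀ n → ⟦ part-list n ⟧ ⊆ part n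
    part-list-sound n x∈ with A , A∈ , refl ← ∈-map⁻ (q n) x∈ =
      part-q n (U-list-sound n ∘ ∈-subsets⁻ (U-list n) A∈)

  mutual
    U-list-complete : ∀ n → U n ⊆ ⟦ U-list n ⟧
    U-list-complete zero (_ , () , _)
    U-list-complete (suc n) (i , i<1+n , x∈Lᵢ) with m<1+n⇒m<n∨m≡n i<1+n
    ... | inj₁ i<n  = ∈-++⁺ˡ (U-list-complete n (i , i<n , x∈Lᵢ))
    ... | inj₂ refl = ∈-++⁺ʳ (U-list n) (part-list-complete n x∈Lᵢ)

    part-list-complete : ∀ n → part n ⊆ ⟦ part-list n ⟧
    part-list-complete n x∈Lₙ with K , K⊆U , refl ← Equivalence.to (part-def n) x∈Lₙ =
      subst (_∈ part-list n) (q-wd n (K⊆U ∘ proj₁ A≐K) A≐K)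
        (∈-map⁺ (q n) (filter∈subsets (_∈? K) (U-list n)))
      where
      A≐K = filter-∈-≐ (U-list-complete n ∘ K⊆U)

  mutual
    U-list-unique : ∀ n → Unique (U-list n)
    U-list-unique zero    = []
    U-list-unique (suc n) = ++⁺ (U-list-unique n) (part-list-unique n)
      (λ (x∈U , x∈P) → part-∉U n (part-list-sound n x∈P) (U-list-sound n x∈U))

    part-list-unique : ∀ n → Unique (part-list n)
    part-list-unique n = map-subsets-unique (U-list-unique n) (q n) λ A⊆ B⊆ qA≡qB →
      proj₂ (q-inj (U-list-sound n ∘ A⊆) (U-list-sound n ∘ B⊆) qA≡qB)

  mutual
    length-U-list : ∀ n → length (U-list n) ≡ S n
    length-U-list zero    = refl
    length-U-list (suc n) = trans (length-++ (U-list n))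
      (cong₂ _+_ (length-U-list n) (trans (length-part-list n) (sym (m≡2^S n))))

    length-part-list : ∀ n → length (part-list n) ≡ 2 ^ S n
    length-part-list n = begin
      length (map (q n) (subsets (U-list n))) ≡⟨ length-map (q n) (subsets (U-list n)) ⟩
      length (subsets (U-list n))             ≡⟨ length-subsets (U-list n) ⟩
      2 ^ length (U-list n)                   ≡⟨ cong (2 ^_) (length-U-list n) ⟩
      2 ^ S n                                 ∎
      where open ≡-Reasoning

  part-size : ∀ n → HasSize (part n) (m n)
  part-size n = part-list n , part-list-unique n , trans (length-part-list n) (sym (m≡2^S n)) ,
                part-list-sound n , part-list-complete n

  U? : ∀ n → Decidable (U n)
  U? n x = map′ (U-list-sound n) (U-list-complete n) (x ∈? U-list n)

  record Label : Set where
    constructor label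
    field
      level : ℕ
      set   : List ℕ
      set⊆U : set ⊆ᴾ U level
  open Label

  q⟨_⟩ : Label → ℕ
  q⟨ A ⟩ = q (level A) (set A)

  LExt⟨_⟩ : Label → Pred ℕ 0ℓ
  LExt⟨ A ⟩ = LExt (level A) (set A)

  Labelled : Pred ℕ 0ℓ
  Labelled x = Σ Label λ A → q⟨ A ⟩ ≡ x

  label-of : ∀ {x} → L x → Labelled x
  label-of x∈L with n , K , K⊆U , refl ← q-surj x∈L = label n K K⊆U , refl

  q⟨⟩∈LExt : ∀ A → LExt⟨ A ⟩ q⟨ A ⟩
  q⟨⟩∈LExt A = q-ext (level A) (set⊆U A)

  q⟨⟩∈L : ∀ A → L q⟨ A ⟩
  q⟨⟩∈L A = proj₁ (q⟨⟩∈LExt A)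

  q⟨⟩∈part : ∀ A → part (level A) q⟨ A ⟩
  q⟨⟩∈part A = part-q (level A) (set⊆U A)

  infix 4 _≅_ _⊑_ _⊏_ _⋖_
  record _≅_ (A B : Label) : Set where
    constructor mk≅
    field
      level-≡ : level A ≡ level B
      set-≐   : ⟦ set A ⟧ ≐ ⟦ set B ⟧

  q⟨⟩-cong : ∀ {A B} → A ≅ B → q⟨ A ⟩ ≡ q⟨ B ⟩
  q⟨⟩-cong {label n _ K⊆U} {label .n _ _} (mk≅ refl K≐K′) = q-wd n K⊆U K≐K′

  q⟨⟩-injective : ∀ {A B} → q⟨ A ⟩ ≡ q⟨ B ⟩ → A ≅ B
  q⟨⟩-injective {A} {B} qA≡qB = let n≡n′ , K≐K′ = q-inj (set⊆U A) (set⊆U B) qA≡qB in mk≅ n≡n′ K≐K′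

  q⟨⟩-level-≢ : ∀ {A B} → level A ≢ level B → q⟨ A ⟩ ≢ q⟨ B ⟩
  q⟨⟩-level-≢ {A} {B} levels≢ = levels≢ ∘ _≅_.level-≡ ∘ q⟨⟩-injective {A} {B}

  record _⊑_ (A B : Label) : Set where
    constructor mk⊑
    field
      level-≥ : level B ≤ level A
      set-≐   : ⟦ set B ⟧ ≐ ⟦ set A ⟧ ∩ U (level B)

  open _⊑_ using (level-≥)

  _⊏_ : Label → Label → Set
  A ⊏ B = A ⊑ B × level B < level A

  ∈LExt⇒⊑ : ∀ {A B} → LExt⟨ B ⟩ q⟨ A ⟩ → A ⊑ B
  ∈LExt⇒⊑ {A@(label m K′ _)} {label n K K⊆U} (_ , ∉Uₙ , ∼K , ≁Uₙ∖K) =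
    mk⊑ n≤m (K⊆K′ , K′∩Uₙ⊆K)
    where
    ∼K′ = proj₁ (proj₂ (proj₂ (q⟨⟩∈LExt A)))
    ≁Uₘ∖K′ = proj₂ (proj₂ (proj₂ (q⟨⟩∈LExt A)))
    n≤m : n ≤ m
    n≤m with n ≤? m
    ... | yes n≤m = n≤m
    ... | no n≰m  = contradiction (m , ≰⇒> n≰m , q⟨⟩∈part A) ∉Uₙ
    K⊆K′ : ∀ {k} → k ∈ K → k ∈ K′ × U n k
    K⊆K′ {k} k∈K with k ∈? K′
    ... | yes k∈K′ = k∈K′ , K⊆U k∈K
    ... | no k∉K′  = contradiction (∼K k∈K) (≁Uₘ∖K′ (U-mono n≤m (K⊆U k∈K)) k∉K′)
    K′∩Uₙ⊆K : ∀ {k} → k ∈ K′ × U n k → k ∈ K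
    K′∩Uₙ⊆K {k} (k∈K′ , k∈Uₙ) with k ∈? K
    ... | yes k∈K = k∈K
    ... | no k∉K  = contradiction (∼K′ k∈K′) (≁Uₙ∖K k∈Uₙ k∉K)

  ⊑⇒LExt-⊆ : ∀ {A B} → A ⊑ B → LExt⟨ A ⟩ ⊆ LExt⟨ B ⟩
  ⊑⇒LExt-⊆ (mk⊑ n≤m K≐K′∩Uₙ) (z∈L , ∉Uₘ , ∼K′ , ≁Uₘ∖K′) =
    z∈L , ∉Uₘ ∘ U-mono n≤m , ∼K′ ∘ proj₁ ∘ proj₁ K≐K′∩Uₙ ,
    λ h∈Uₙ h∉K → ≁Uₘ∖K′ (U-mono n≤m h∈Uₙ) (λ h∈K′ → h∉K (proj₂ K≐K′∩Uₙ (h∈K′ , h∈Uₙ)))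

  ⊑-respˡ-≅ : ∀ {A A′ B} → A ≅ A′ → A ⊑ B → A′ ⊑ B
  ⊑-respˡ-≅ (mk≅ refl A≐A′) (mk⊑ n≤m B≐A∩U) =
    mk⊑ n≤m ((λ y∈B → let y∈A , y∈U = proj₁ B≐A∩U y∈B in proj₁ A≐A′ y∈A , y∈U) ,
             (λ (y∈A′ , y∈U) → proj₂ B≐A∩U (proj₂ A≐A′ y∈A′ , y∈U)))

  ⊑-respʳ-≅ : ∀ {A B B′} → B ≅ B′ → A ⊑ B → A ⊑ B′
  ⊑-respʳ-≅ (mk≅ refl B≐B′) (mk⊑ n≤m B≐A∩U) =
    mk⊑ n≤m (proj₁ B≐A∩U ∘ proj₂ B≐B′ , proj₁ B≐B′ ∘ proj₂ B≐A∩U)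

  ⊑⇒≤L : ∀ {A B} → A ⊑ B → q⟨ A ⟩ ≤L q⟨ B ⟩
  ⊑⇒≤L {A} {B} A⊑B = level A , set A , level B , set B , set⊆U A , set⊆U B , refl , refl ,
                     ⊑⇒LExt-⊆ A⊑B

  ≤L⇒⊑ : ∀ {A B} → q⟨ A ⟩ ≤L q⟨ B ⟩ → A ⊑ B
  ≤L⇒⊑ (m , K′ , n , K , K′⊆U , K⊆U , qA′≡qA , qB′≡qB , LExt⊆) =
    ⊑-respʳ-≅ (q⟨⟩-injective qB′≡qB) (⊑-respˡ-≅ (q⟨⟩-injective qA′≡qA)
      (∈LExt⇒⊑ {label m K′ K′⊆U} {label n K K⊆U} (LExt⊆ (q⟨⟩∈LExt (label m K′ K′⊆U)))))

  ≤L-labelled : ∀ {x y} → x ≤L y → Labelled x × Labelled y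
  ≤L-labelled (m , K′ , n , K , K′⊆U , K⊆U , qA≡x , qB≡y , _) =
    (label m K′ K′⊆U , qA≡x) , (label n K K⊆U , qB≡y)

  ≤L-≐-LExt : ∀ A → (_≤L q⟨ A ⟩) ≐ LExt⟨ A ⟩
  ≤L-≐-LExt A = into , out
    where
    into : (_≤L q⟨ A ⟩) ⊆ LExt⟨ A ⟩
    into y≤qA with (B , refl) , _ ← ≤L-labelled y≤qA = ⊑⇒LExt-⊆ (≤L⇒⊑ {B} {A} y≤qA) (q⟨⟩∈LExt B)
    out : LExt⟨ A ⟩ ⊆ (_≤L q⟨ A ⟩)
    out y∈LExt with B , refl ← label-of (proj₁ y∈LExt) = ⊑⇒≤L (∈LExt⇒⊑ {B} {A} y∈LExt)

  ⊑-refl : ∀ A → A ⊑ A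
  ⊑-refl A = mk⊑ ≤-refl ((λ y∈A → y∈A , set⊆U A y∈A) , proj₁)

  ⊑-trans : ∀ {A B C} → A ⊑ B → B ⊑ C → A ⊑ C
  ⊑-trans (mk⊑ n≤m B≐A∩U) (mk⊑ k≤n C≐B∩U) =
    mk⊑ (≤-trans k≤n n≤m)
      ((λ y∈C → let y∈B , y∈Uₖ = proj₁ C≐B∩U y∈C in proj₁ (proj₁ B≐A∩U y∈B) , y∈Uₖ) ,
       (λ (y∈A , y∈Uₖ) → proj₂ C≐B∩U (proj₂ B≐A∩U (y∈A , U-mono k≤n y∈Uₖ) , y∈Uₖ)))

  ⊑-level-≡⇒≅ : ∀ {A B} → A ⊑ B → level A ≡ level B → A ≅ B
  ⊑-level-≡⇒≅ {A} (mk⊑ _ B≐A∩U) refl =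
    mk≅ refl ((λ y∈A → proj₂ B≐A∩U (y∈A , set⊆U A y∈A)) , proj₁ ∘ proj₁ B≐A∩U)

  ⊑-linear : ∀ {A B C} → A ⊑ B → A ⊑ C → level C ≤ level B → B ⊑ C
  ⊑-linear (mk⊑ _ B≐A∩U) (mk⊑ _ C≐A∩U) k≤n =
    mk⊑ k≤n
      ((λ y∈C → let y∈A , y∈Uₖ = proj₁ C≐A∩U y∈C in proj₂ B≐A∩U (y∈A , U-mono k≤n y∈Uₖ) , y∈Uₖ) ,
       (λ (y∈B , y∈Uₖ) → proj₂ C≐A∩U (proj₁ (proj₁ B≐A∩U y∈B) , y∈Uₖ)))

  infixl 6 _↾_
  _↾_ : Label → ℕ → Label
  A ↾ k = label k (filter (U? k) (set A)) (proj₂ ∘ ∈-filter⁻ (U? k) {xs = set A})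

  ⊑-↾ : ∀ {A k} → k ≤ level A → A ⊑ A ↾ k
  ⊑-↾ {A} {k} k≤n = mk⊑ k≤n (∈-filter⁻ (U? k) {xs = set A} , λ (y∈A , y∈Uₖ) → ∈-filter⁺ (U? k) y∈A y∈Uₖ)

  ⊑⇒≅↾ : ∀ {A B} → A ⊑ B → B ≅ A ↾ level B
  ⊑⇒≅↾ A⊑B = ⊑-level-≡⇒≅ (⊑-linear A⊑B (⊑-↾ (level-≥ A⊑B)) ≤-refl) refl

  ⊏⇒<L : ∀ {A B} → A ⊏ B → q⟨ A ⟩ <L q⟨ B ⟩
  ⊏⇒<L {A} {B} (A⊑B , k<n) = ⊑⇒≤L A⊑B , q⟨⟩-level-≢ {A} {B} (>⇒≢ k<n)

  <L⇒⊏ : ∀ {A B} → q⟨ A ⟩ <L q⟨ B ⟩ → A ⊏ B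
  <L⇒⊏ (qA≤qB , qA≢qB) = A⊑B , ≤∧≢⇒< (level-≥ A⊑B) (qA≢qB ∘ q⟨⟩-cong ∘ ⊑-level-≡⇒≅ A⊑B ∘ sym)
    where A⊑B = ≤L⇒⊑ qA≤qB

  top-label : Label
  top-label = label 0 [] (λ ())

  ⊑-top : ∀ A → A ⊑ top-label
  ⊑-top A = mk⊑ z≤n ((λ ()) , λ { (_ , (_ , () , _)) })

  ≤L-top : ∀ {x} → L x → x ≤L top
  ≤L-top x∈L with A , refl ← label-of x∈L = ⊑⇒≤L (⊑-top A)

  <L-≐-⊏ : ∀ A → (q⟨ A ⟩ <L_) ≐ (λ y → ∃ λ B → A ⊏ B × q⟨ B ⟩ ≡ y)
  <L-≐-⊏ A = above , λ { (B , A⊏B , refl) → ⊏⇒<L A⊏B }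
    where
    above : ∀ {y} → q⟨ A ⟩ <L y → ∃ λ B → A ⊏ B × q⟨ B ⟩ ≡ y
    above qA<y@(qA≤y , _) with _ , (B , refl) ← ≤L-labelled qA≤y = B , <L⇒⊏ qA<y , refl

  <L-≤L-top-≐-restrictions : ∀ A →
    (λ y → q⟨ A ⟩ <L y × y ≤L top) ≐
    (λ y → ∃ λ k → k < level A × ∃ λ K′ → K′ ⊆ᴾ U k × (⟦ K′ ⟧ ≐ (⟦ set A ⟧ ∩ U k)) × q k K′ ≡ y)
  <L-≤L-top-≐-restrictions A = restriction , λ { (k , k<n , K′ , K′⊆U , K′≐K∩Uₖ , refl) →
    let B = label k K′ K′⊆U in ⊏⇒<L {A} {B} (mk⊑ (<⇒≤ k<n) K′≐K∩Uₖ , k<n) , ≤L-top (q⟨⟩∈L B) }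
    where
    restriction : ∀ {y} → q⟨ A ⟩ <L y × y ≤L top →
      ∃ λ k → k < level A × ∃ λ K′ → K′ ⊆ᴾ U k × (⟦ K′ ⟧ ≐ (⟦ set A ⟧ ∩ U k)) × q k K′ ≡ y
    restriction (qA<y , _) with B , (mk⊑ _ B≐A∩U , k<n) , refl ← proj₁ (<L-≐-⊏ A) qA<y =
      level B , k<n , set B , set⊆U B , B≐A∩U , refl

  ancestors : Label → List ℕ
  ancestors A = map (λ k → q⟨ A ↾ k ⟩) (upTo (level A))

  ancestors-size : ∀ A → HasSize (q⟨ A ⟩ <L_) (level A)
  ancestors-size A =
    ancestors A ,
    map⁺ (λ {i j} → _≅_.level-≡ ∘ q⟨⟩-injective {A ↾ i} {A ↾ j}) (upTo⁺ (level A)) ,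
    trans (length-map (λ k → q⟨ A ↾ k ⟩) (upTo (level A))) (length-upTo (level A)) ,
    sound , complete
    where
    sound : ∀ {y} → y ∈ ancestors A → q⟨ A ⟩ <L y
    sound y∈ with k , k∈ , refl ← ∈-map⁻ _ y∈ = ⊏⇒<L (⊑-↾ {A} (<⇒≤ k<n) , k<n)
      where k<n = ∈-upTo⁻ k∈
    complete : ∀ {y} → q⟨ A ⟩ <L y → y ∈ ancestors A
    complete qA<y with B , (A⊑B , k<n) , refl ← proj₁ (<L-≐-⊏ A) qA<y =
      subst (_∈ ancestors A) (sym (q⟨⟩-cong (⊑⇒≅↾ A⊑B))) (∈-map⁺ _ (∈-upTo⁺ k<n))

  _⋖_ : Label → Label → Set
  B ⋖ A = B ⊑ A × level B ≡ suc (level A)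

  ⋖⇒ImmPred : ∀ {A B} → B ⋖ A → ImmPred _≤L_ q⟨ A ⟩ q⟨ B ⟩
  ⋖⇒ImmPred {A} {B} (B⊑A , refl) = ⊏⇒<L (B⊑A , n<1+n (level A)) , nothing-between
    where
    nothing-between : ¬ ∃ λ z → q⟨ B ⟩ <L z × z <L q⟨ A ⟩
    nothing-between (z , qB<z@(qB≤z , _) , z<qA) with _ , (C , refl) ← ≤L-labelled qB≤z =
      <-irrefl refl (<-≤-trans (proj₂ (<L⇒⊏ {C} {A} z<qA)) (≤-pred (proj₂ (<L⇒⊏ {B} {C} qB<z))))

  ImmPred⇒⋖ : ∀ {A B} → ImmPred _≤L_ q⟨ A ⟩ q⟨ B ⟩ → B ⋖ A
  ImmPred⇒⋖ {A} {B} (qB<qA , nothing-between) with B⊑A , n<k ← <L⇒⊏ qB<qA =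
    B⊑A , level≡
    where
    level≡ : level B ≡ suc (level A)
    level≡ with m≤n⇒m<n∨m≡n n<k
    ... | inj₂ 1+n≡k  = sym 1+n≡k
    ... | inj₁ 1+n<k = contradiction  -- B ↾ (n + 1) would lie strictly between B and A
      (q⟨ B ↾ suc (level A) ⟩ ,
       ⊏⇒<L (⊑-↾ {B} (<⇒≤ 1+n<k) , 1+n<k) ,
       ⊏⇒<L (⊑-linear (⊑-↾ (<⇒≤ 1+n<k)) B⊑A (n≤1+n (level A)) , n<1+n (level A)))
      nothing-between

  ImmPred-≐-⋖ : ∀ A → ImmPred _≤L_ q⟨ A ⟩ ≐ (λ y → ∃ λ B → B ⋖ A × q⟨ B ⟩ ≡ y)
  ImmPred-≐-⋖ A = child , λ { (B , B⋖A , refl) → ⋖⇒ImmPred B⋖A }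
    where
    child : ∀ {y} → ImmPred _≤L_ q⟨ A ⟩ y → ∃ λ B → B ⋖ A × q⟨ B ⟩ ≡ y
    child imm@((y≤qA , _) , _) with (B , refl) , _ ← ≤L-labelled y≤qA = B , ImmPred⇒⋖ imm , refl

  extend-⊆U : ∀ A {K₁} → K₁ ⊆ᴾ part (level A) → (set A ++ K₁) ⊆ᴾ U (suc (level A))
  extend-⊆U A K₁⊆Lₙ y∈ with ∈-++⁻ (set A) y∈
  ... | inj₁ y∈K  = U-mono (n≤1+n (level A)) (set⊆U A y∈K)
  ... | inj₂ y∈K₁ = level A , n<1+n (level A) , K₁⊆Lₙ y∈K₁

  extend : (A : Label) (K₁ : List ℕ) → K₁ ⊆ᴾ part (level A) → Label
  extend A K₁ K₁⊆Lₙ = label (suc (level A)) (set A ++ K₁) (extend-⊆U A K₁⊆Lₙ)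

  extend-⋖ : ∀ A {K₁} (K₁⊆Lₙ : K₁ ⊆ᴾ part (level A)) → extend A K₁ K₁⊆Lₙ ⋖ A
  extend-⋖ A {K₁} K₁⊆Lₙ = mk⊑ (n≤1+n (level A)) ((λ y∈K → ∈-++⁺ˡ y∈K , set⊆U A y∈K) , drop-K₁) , refl
    where
    drop-K₁ : ∀ {y} → y ∈ set A ++ K₁ × U (level A) y → y ∈ set A
    drop-K₁ (y∈ , y∈Uₙ) with ∈-++⁻ (set A) y∈
    ... | inj₁ y∈K  = y∈K
    ... | inj₂ y∈K₁ = contradiction y∈Uₙ (part-∉U (level A) (K₁⊆Lₙ y∈K₁))

  ⋖⇒extend : ∀ {A B} → B ⋖ A → ∃ λ K₁ → Σ (K₁ ⊆ᴾ part (level A)) λ K₁⊆Lₙ → B ≅ extend A K₁ K₁⊆Lₙ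
  ⋖⇒extend {A} {label _ J J⊆U} (mk⊑ _ A≐J∩Uₙ , refl) = K₁ , K₁⊆Lₙ , mk≅ refl J≐K++K₁
    where
    n = level A
    outside? = ¬? ∘ U? n
    K₁ = filter outside? J
    K₁⊆Lₙ : K₁ ⊆ᴾ part n
    K₁⊆Lₙ y∈K₁ with y∈J , y∉Uₙ ← ∈-filter⁻ outside? {xs = J} y∈K₁
                 with i , i<1+n , y∈Lᵢ ← J⊆U y∈J
                 with m<1+n⇒m<n∨m≡n i<1+n
    ... | inj₁ i<n  = contradiction (i , i<n , y∈Lᵢ) y∉Uₙ
    ... | inj₂ refl = y∈Lᵢ
    J≐K++K₁ : ⟦ J ⟧ ≐ ⟦ set A ++ K₁ ⟧
    J≐K++K₁ = split , join
      where
      split : ∀ {y} → y ∈ J → y ∈ set A ++ K₁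
      split {y} y∈J with U? n y
      ... | yes y∈Uₙ = ∈-++⁺ˡ (proj₂ A≐J∩Uₙ (y∈J , y∈Uₙ))
      ... | no y∉Uₙ  = ∈-++⁺ʳ (set A) (∈-filter⁺ outside? y∈J y∉Uₙ)
      join : ∀ {y} → y ∈ set A ++ K₁ → y ∈ J
      join y∈ with ∈-++⁻ (set A) y∈
      ... | inj₁ y∈K  = proj₁ (proj₁ A≐J∩Uₙ y∈K)
      ... | inj₂ y∈K₁ = proj₁ (∈-filter⁻ outside? {xs = J} y∈K₁)

  ImmPred-≐-extensions : ∀ A → ImmPred _≤L_ q⟨ A ⟩ ≐
    (λ y → ∃ λ K₁ → K₁ ⊆ᴾ part (level A) × q (suc (level A)) (set A ++ K₁) ≡ y)
  ImmPred-≐-extensions A = extension , λ { (K₁ , K₁⊆Lₙ , refl) → ⋖⇒ImmPred (extend-⋖ A K₁⊆Lₙ) }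
    where
    extension : ∀ {y} → ImmPred _≤L_ q⟨ A ⟩ y →
                ∃ λ K₁ → K₁ ⊆ᴾ part (level A) × q (suc (level A)) (set A ++ K₁) ≡ y
    extension imm with B , B⋖A , refl ← proj₁ (ImmPred-≐-⋖ A) imm
                  with K₁ , K₁⊆Lₙ , B≅ ← ⋖⇒extend B⋖A =
      K₁ , K₁⊆Lₙ , sym (q⟨⟩-cong B≅)

  children : Label → List ℕ
  children A = map (λ K₁ → q (suc (level A)) (set A ++ K₁)) (subsets (part-list (level A)))

  children-size : ∀ A → HasSize (ImmPred _≤L_ q⟨ A ⟩) (2 ^ m (level A))
  children-size A =
    children A ,
    map-subsets-unique (part-list-unique n) _ extension-injective ,
    length-children ,
    sound , complete
    where
    n = level A
    K = set A
    part-#K : ∀ {K₁} → K₁ ⊆ᴾ part n → ∀ {y} → y ∈ K₁ → y ∉ K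
    part-#K K₁⊆Lₙ y∈K₁ y∈K = part-∉U n (K₁⊆Lₙ y∈K₁) (set⊆U A y∈K)
    extension-injective : ∀ {K₁ K₂} → K₁ ⊆ˡ part-list n → K₂ ⊆ˡ part-list n →
                          q (suc n) (K ++ K₁) ≡ q (suc n) (K ++ K₂) → ⟦ K₁ ⟧ ≐ ⟦ K₂ ⟧
    extension-injective {K₁} {K₂} K₁⊆ K₂⊆ q≡ =
      ++-cancelˡ-≐ K (part-#K K₁⊆Lₙ) (part-#K K₂⊆Lₙ)
        (_≅_.set-≐ (q⟨⟩-injective {extend A K₁ K₁⊆Lₙ} {extend A K₂ K₂⊆Lₙ} q≡))
      where
      K₁⊆Lₙ : K₁ ⊆ᴾ part n
      K₁⊆Lₙ = part-list-sound n ∘ K₁⊆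
      K₂⊆Lₙ : K₂ ⊆ᴾ part n
      K₂⊆Lₙ = part-list-sound n ∘ K₂⊆
    length-children : length (children A) ≡ 2 ^ m n
    length-children = begin
      length (children A)             ≡⟨ length-map _ (subsets (part-list n)) ⟩
      length (subsets (part-list n))  ≡⟨ length-subsets (part-list n) ⟩
      2 ^ length (part-list n)        ≡⟨ cong (2 ^_) (trans (length-part-list n) (sym (m≡2^S n))) ⟩
      2 ^ m n                         ∎
      where open ≡-Reasoning
    sound : ∀ {y} → y ∈ children A → ImmPred _≤L_ q⟨ A ⟩ y
    sound y∈ with K₁ , K₁∈ , refl ← ∈-map⁻ _ y∈ =
      ⋖⇒ImmPred (extend-⋖ A (part-list-sound n ∘ ∈-subsets⁻ (part-list n) K₁∈))
    complete : ∀ {y} → ImmPred _≤L_ q⟨ A ⟩ y → y ∈ children A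
    complete imm with B , B⋖A , refl ← proj₁ (ImmPred-≐-⋖ A) imm
                 with K₁ , K₁⊆Lₙ , B≅K++K₁ ← ⋖⇒extend B⋖A =
      subst (_∈ children A) (sym (trans (q⟨⟩-cong B≅K++K₁) (q-wd (suc n) (extend-⊆U A K₁⊆Lₙ) K++K₁≐)))
        (∈-map⁺ _ (filter∈subsets (_∈? K₁) (part-list n)))
      where
      K++K₁≐ : ⟦ K ++ K₁ ⟧ ≐ ⟦ K ++ filter (_∈? K₁) (part-list n) ⟧
      K++K₁≐ = ++-≐ʳ K (swap (filter-∈-≐ (part-list-complete n ∘ K₁⊆Lₙ)))

  <L-upward-wellFounded : WellFounded (flip _<L_)
  <L-upward-wellFounded x = acc above
    where
    acc-label : ∀ B → Acc _<_ (level B) → Acc (flip _<L_) q⟨ B ⟩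
    acc-label B (acc rec) = acc step
      where
      step : ∀ {y} → q⟨ B ⟩ <L y → Acc (flip _<L_) y
      step qB<y@(qB≤y , _) with _ , (C , refl) ← ≤L-labelled qB≤y =
        acc-label C (rec (proj₂ (<L⇒⊏ {B} {C} qB<y)))
    above : ∀ {y} → x <L y → Acc (flip _<L_) y
    above (x≤y , _) with _ , (B , refl) ← ≤L-labelled x≤y = acc-label B (<-wellFounded (level B))

  reversedTree : ReversedTree L _≤L_
  reversedTree = record
    { dom          = dom
    ; reflexive    = reflexive
    ; trans        = ≤L-trans
    ; antisym      = antisym
    ; above-linear = above-linear
    ; above-wf     = λ _ → Subrelation.wellFounded (proj₂ ∘ proj₂) <L-upward-wellFounded
    }
    where
    dom : ∀ {x y} → x ≤L y → L x × L y
    dom x≤y with (A , refl) , (B , refl) ← ≤L-labelled x≤y = q⟨⟩∈L A , q⟨⟩∈L B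
    reflexive : ∀ {x} → L x → x ≤L x
    reflexive x∈L with A , refl ← label-of x∈L = ⊑⇒≤L (⊑-refl A)
    ≤L-trans : ∀ {x y z} → x ≤L y → y ≤L z → x ≤L z
    ≤L-trans x≤y y≤z with (A , refl) , (B , refl) ← ≤L-labelled x≤y
                     with _ , (C , refl) ← ≤L-labelled y≤z =
      ⊑⇒≤L (⊑-trans (≤L⇒⊑ {A} {B} x≤y) (≤L⇒⊑ {B} {C} y≤z))
    antisym : ∀ {x y} → x ≤L y → y ≤L x → x ≡ y
    antisym x≤y y≤x with (A , refl) , (B , refl) ← ≤L-labelled x≤y =
      q⟨⟩-cong (⊑-level-≡⇒≅ A⊑B (≤-antisym (level-≥ (≤L⇒⊑ {B} {A} y≤x)) (level-≥ A⊑B)))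
      where A⊑B = ≤L⇒⊑ {A} {B} x≤y
    above-linear : ∀ {x y z} → L x → x <L y → x <L z → (y ≤L z) ⊎ (z ≤L y)
    above-linear _ (x≤y , _) (x≤z , _)
      with (A , refl) , (B , refl) ← ≤L-labelled x≤y
      with _ , (C , refl) ← ≤L-labelled x≤z
      with ≤-total (level B) (level C)
    ... | inj₁ n≤k = inj₂ (⊑⇒≤L (⊑-linear (≤L⇒⊑ {A} {C} x≤z) (≤L⇒⊑ {A} {B} x≤y) n≤k))
    ... | inj₂ k≤n = inj₁ (⊑⇒≤L (⊑-linear (≤L⇒⊑ {A} {B} x≤y) (≤L⇒⊑ {A} {C} x≤z) k≤n))

  part-≐-Level : ∀ n → part n ≐ Level _≤L_ L n
  part-≐-Level n = into , out
    where
    into : part n ⊆ Level _≤L_ L n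
    into x∈Lₙ with K , K⊆U , refl ← Equivalence.to (part-def n) x∈Lₙ =
      part-⊆ n x∈Lₙ , ancestors-size (label n K K⊆U)
    out : Level _≤L_ L n ⊆ part n
    out (x∈L , n-above) with A , refl ← label-of x∈L =
      subst (λ k → part k q⟨ A ⟩) (HasSize-unique (ancestors-size A) n-above) (q⟨⟩∈part A)

  children-size-part : ∀ n x → part n x → HasSize (ImmPred _≤L_ x) (2 ^ m n)
  children-size-part n x x∈Lₙ with K , K⊆U , refl ← Equivalence.to (part-def n) x∈Lₙ =
    children-size (label n K K⊆U)

  finitely-branching : ∀ x → L x → ∃ λ k → HasSize (ImmPred _≤L_ x) k
  finitely-branching x x∈L with A , refl ← label-of x∈L = 2 ^ m (level A) , children-size A

  no-minimal : ∀ x → L x → ∃ λ y → y <L x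
  no-minimal x x∈L with A , refl ← label-of x∈L =
    q⟨ extend A [] (λ ()) ⟩ , proj₁ (⋖⇒ImmPred (extend-⋖ A (λ ())))

theorem8p1 : (G : Graph) → IsRado G → (L : Pred ℕ 0ℓ) → InP G L → (lab : Labeling G L) →
    let open Labeling lab in
    (∀ n K → K ⊆ᴾ U n →
        ((λ y → q n K <L y × y ≤L top)
          ≐ (λ y → ∃ λ k → k < n × ∃ λ K' → K' ⊆ᴾ U k × (⟦ K' ⟧ ≐ (⟦ K ⟧ ∩ U k)) × q k K' ≡ y))
      × ((λ y → y ≤L q n K) ≐ LExt n K)
      × (ImmPred _≤L_ (q n K) ≐ (λ y → ∃ λ K₁ → K₁ ⊆ᴾ part n × q (suc n) (K ++ K₁) ≡ y)))
    × (ReversedTree L _≤L_ × (∀ x → L x → x ≤L top) × (∀ n → part n ≐ Level _≤L_ L n))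
    × ((∀ x → L x → ∃ λ k → HasSize (ImmPred _≤L_ x) k)
      × (∀ x → L x → ∃ λ y → y <L x)
      × (∀ n → HasSize (part n) (m n) × (∀ x → part n x → HasSize (ImmPred _≤L_ x) (2 ^ m n))))
theorem8p1 G _ L _ lab =
  (λ n K K⊆U → let A = label n K K⊆U in
     <L-≤L-top-≐-restrictions A , ≤L-≐-LExt A , ImmPred-≐-extensions A) ,
  (reversedTree , (λ _ → ≤L-top) , part-≐-Level) ,
  (finitely-branching , no-minimal , λ n → part-size n , children-size-part n)
  where open LabelOrder G L lab
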